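{- Let $r\ge2$ be an integer. The sequence $(b^{(r)}_n)_{n\in\mathbb{N}}$ contains arbitrarily long runs of consecutive $0$'s, and the maximal length of a run of consecutive $1$'s in it is equal to $2$.
   Context: For an integer $r\ge2$, the sequence $(b^{(r)}_n)_{n\in\mathbb{N}}$ is defined by $b^{(r)}_0=1$ and, for $n\ge1$, $b^{(r)}_n=1$ if every maximal block of consecutive $0$'s in the binary expansion of $n$ has length divisible by $r$, and $b^{(r)}_n=0$ otherwise. -}

module Defs where

open import Data.Nat using (ℕ; zero; suc; _+_; _*_; _%_; _/_)
open import Data.Nat.Divisibility using (_∣_)
open import Data.Bool using (Bool; true; false)
open import Data.List using (List; []; _∷_)
open import Data.List.Relation.Unary.All using (All)

-- Binary digits of n, least significant first, without leading zeros
-- (so binDigits 0 = []). The first argument is fuel (n suffices).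
binDigitsAux : ℕ → ℕ → List Bool
binDigitsAux zero    _       = []
binDigitsAux (suc f) zero    = []
binDigitsAux (suc f) (suc m) with (suc m) % 2
... | zero  = false ∷ binDigitsAux f (suc m / 2)
... | suc _ = true  ∷ binDigitsAux f (suc m / 2)

binDigits : ℕ → List Bool
binDigits n = binDigitsAux n n

-- Lengths of the maximal blocks of consecutive false's (0 digits) in a list.
-- The accumulator is the length of the current (unfinished) block of 0's.
zeroBlocksAux : ℕ → List Bool → List ℕ
zeroBlocksAux zero    []           = []
zeroBlocksAux (suc k) []           = suc k ∷ []
zeroBlocksAux k       (false ∷ bs) = zeroBlocksAux (suc k) bs
zeroBlocksAux zero    (true ∷ bs)  = zeroBlocksAux zero bs
zeroBlocksAux (suc k) (true ∷ bs)  = suc k ∷ zeroBlocksAux zero bs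

zeroBlocks : List Bool → List ℕ
zeroBlocks = zeroBlocksAux zero

-- b^{(r)}_n = 1 iff n = 0, or every maximal block of 0's in the binary
-- expansion of n has length divisible by r.
-- As a predicate: IsOne r n holds iff b^{(r)}_n = 1.
IsOne : ℕ → ℕ → Set
IsOne r zero    = Data.Unit.⊤
  where import Data.Unit
IsOne r (suc n) = All (λ ℓ → r ∣ ℓ) (zeroBlocks (binDigits (suc n)))

IsZero : ℕ → ℕ → Set
IsZero r n = IsOne r n → Data.Empty.⊥
  where import Data.Empty

-- The expansions of 2(q+1) and 2(q+1)+1 share
--    all digits but the last, so their lowest blocks of 0's have lengths
--    a+1 and a; r cannot divide both.  Among m, m+1, m+2 such a pair
--    always occurs, except for m = 0, where 2 = (10)₂ has a block of length 1.
--    The pair (0, 1) shows that runs of length 2 occur.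
-- 3. Long runs of 0's.  Every number whose three leading binary digits are
--    101 has a block of 0's of length 1, hence b⁽ʳ⁾ vanishes there; the
--    2^K consecutive numbers 5·2^K, …, 6·2^K − 1 all have leading digits 101.
module Submission where

open import Defs
open import Data.Nat using (ℕ; _+_; _<_; _≤_)
open import Data.Product using (Σ; _×_; _,_)
open import Relation.Nullary using (¬_)

open import Data.Nat using (zero; suc; _*_; _%_; _/_; _^_; z≤n; s≤s)
open import Data.Nat.Properties
open import Data.Nat.DivMod using (m*n%n≡0; m*n/n≡m; [m+kn]%n≡m%n; +-distrib-/; m/n<m)
open import Data.Nat.Divisibility using (_∣_; ∣1⇒≡1; ∣m+n∣m⇒∣n)
open import Data.Bool using (Bool; true; false)
open import Data.List using (List; []; _∷_; _++_)
open import Data.List.Relation.Unary.All as All using (All; _∷_)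
open import Data.List.Relation.Unary.Any using (here; there)
open import Data.List.Membership.Propositional using (_∈_)
open import Data.Sum using (_⊎_; inj₁; inj₂)
open import Relation.Binary.PropositionalEquality

unfoldEven : ∀ f m → suc m % 2 ≡ 0 →
  binDigitsAux (suc f) (suc m) ≡ false ∷ binDigitsAux f (suc m / 2)
unfoldEven f m even rewrite even = refl

unfoldOdd : ∀ f m → suc m % 2 ≡ 1 →
  binDigitsAux (suc f) (suc m) ≡ true ∷ binDigitsAux f (suc m / 2)
unfoldOdd f m odd rewrite odd = refl

half<suc : ∀ m → suc m / 2 ≤ m
half<suc m = ≤-pred (m/n<m (suc m) 2 (s≤s (s≤s z≤n)))

fuelIrrelevant : ∀ {f g} m → m ≤ f → m ≤ g → binDigitsAux f m ≡ binDigitsAux g m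
fuelIrrelevant {zero}  {zero}  zero    _         _         = refl
fuelIrrelevant {zero}  {suc g} zero    _         _         = refl
fuelIrrelevant {suc f} {zero}  zero    _         _         = refl
fuelIrrelevant {suc f} {suc g} zero    _         _         = refl
fuelIrrelevant {suc f} {suc g} (suc m) (s≤s m≤f) (s≤s m≤g) with suc m % 2
... | zero  = cong (false ∷_) (fuelIrrelevant (suc m / 2) (≤-trans (half<suc m) m≤f) (≤-trans (half<suc m) m≤g))
... | suc _ = cong (true ∷_)  (fuelIrrelevant (suc m / 2) (≤-trans (half<suc m) m≤f) (≤-trans (half<suc m) m≤g))

binDigits-even : ∀ q → binDigits (suc q * 2) ≡ false ∷ binDigits (suc q)
binDigits-even q = begin
  binDigits (suc q * 2)
    ≡⟨ unfoldEven (suc (q * 2)) (suc (q * 2)) (m*n%n≡0 (suc q) 2) ⟩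
  false ∷ binDigitsAux (suc (q * 2)) (suc q * 2 / 2)
    ≡⟨ cong (λ h → false ∷ binDigitsAux (suc (q * 2)) h) (m*n/n≡m (suc q) 2) ⟩
  false ∷ binDigitsAux (suc (q * 2)) (suc q)
    ≡⟨ cong (false ∷_) (fuelIrrelevant (suc q) (s≤s (m≤m*n q 2)) ≤-refl) ⟩
  false ∷ binDigits (suc q) ∎
  where open ≡-Reasoning

binDigits-odd : ∀ q → binDigits (1 + q * 2) ≡ true ∷ binDigits q
binDigits-odd q = begin
  binDigits (1 + q * 2)
    ≡⟨ unfoldOdd (q * 2) (q * 2) ([m+kn]%n≡m%n 1 q 2) ⟩
  true ∷ binDigitsAux (q * 2) ((1 + q * 2) / 2)
    ≡⟨ cong (λ h → true ∷ binDigitsAux (q * 2) h) half ⟩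
  true ∷ binDigitsAux (q * 2) q
    ≡⟨ cong (true ∷_) (fuelIrrelevant q (m≤m*n q 2) ≤-refl) ⟩
  true ∷ binDigits q ∎
  where
  open ≡-Reasoning
  half : (1 + q * 2) / 2 ≡ q
  half = trans (+-distrib-/ 1 (q * 2) (subst (λ x → 1 + x < 2) (sym (m*n%n≡0 q 2)) ≤-refl))
               (m*n/n≡m q 2)

parity : ∀ m → Σ ℕ (λ q → (m ≡ q * 2) ⊎ (m ≡ 1 + q * 2))
parity zero = 0 , inj₁ refl
parity (suc m) with parity m
... | q , inj₁ refl = q , inj₂ refl
... | q , inj₂ refl = suc q , inj₁ refl

module Blocks (r : ℕ) (r≢1 : r ≢ 1) where

  ∤1 : ¬ (r ∣ 1)
  ∤1 r∣1 = r≢1 (∣1⇒≡1 r∣1)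

  ∤consecutive : ∀ a → r ∣ a → ¬ (r ∣ suc a)
  ∤consecutive a r∣a r∣1+a = ∤1 (∣m+n∣m⇒∣n (subst (r ∣_) (+-comm 1 a) r∣1+a) r∣a)

  -- Starting the block count at k+1 instead of k lengthens only the lowest
  -- block, by one; so both block lists cannot consist of multiples of r.
  shiftedBlocks : ∀ k ds → All (r ∣_) (zeroBlocksAux (suc k) ds) →
                  ¬ All (r ∣_) (zeroBlocksAux k ds)
  shiftedBlocks zero    []           (r∣1 ∷ _) _              = ∤1 r∣1
  shiftedBlocks (suc k) []           (r∣a ∷ _) (r∣a-1 ∷ _)    = ∤consecutive (suc k) r∣a-1 r∣a
  shiftedBlocks zero    (false ∷ ds) long      short          = shiftedBlocks 1 ds long short
  shiftedBlocks (suc k) (false ∷ ds) long      short          = shiftedBlocks (suc (suc k)) ds long short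
  shiftedBlocks zero    (true ∷ ds)  (r∣1 ∷ _) _              = ∤1 r∣1
  shiftedBlocks (suc k) (true ∷ ds)  (r∣a ∷ _) (r∣a-1 ∷ _)    = ∤consecutive (suc k) r∣a-1 r∣a

  evenOddPair : ∀ q → IsOne r (suc q * 2) → ¬ IsOne r (1 + suc q * 2)
  evenOddPair q even odd
    rewrite binDigits-even q | binDigits-odd (suc q) = shiftedBlocks 0 (binDigits (suc q)) even odd

  noThreeOnes : ∀ m → ¬ (IsOne r m × IsOne r (m + 1) × IsOne r (m + 2))
  noThreeOnes m ones with parity m
  noThreeOnes m (_ , _ , r∣1 ∷ _) | zero , inj₁ refl = ∤1 r∣1
  noThreeOnes m (even , odd , _)  | suc p , inj₁ refl =
    evenOddPair p even (subst (IsOne r) (+-comm (suc p * 2) 1) odd)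
  noThreeOnes m (_ , even , odd)  | q , inj₂ refl =
    evenOddPair q (subst (IsOne r) (+-comm (1 + q * 2) 1) even)
                  (subst (IsOne r) (+-comm (1 + q * 2) 2) odd)

-- The binary expansion of n ends, at its most significant end, in 1,0,1.
LeadingDigits101 : ℕ → Set
LeadingDigits101 n = Σ (List Bool) (λ low → binDigits n ≡ low ++ true ∷ false ∷ true ∷ [])

blockOfLength1 : ∀ k low → 1 ∈ zeroBlocksAux k (low ++ true ∷ false ∷ true ∷ [])
blockOfLength1 zero    []           = here refl
blockOfLength1 (suc k) []           = there (here refl)
blockOfLength1 zero    (false ∷ low) = blockOfLength1 1 low
blockOfLength1 (suc k) (false ∷ low) = blockOfLength1 (suc (suc k)) low
blockOfLength1 zero    (true ∷ low)  = blockOfLength1 zero low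
blockOfLength1 (suc k) (true ∷ low)  = there (blockOfLength1 zero low)

leading101⇒zero : ∀ r → r ≢ 1 → ∀ n → LeadingDigits101 n → IsZero r n
leading101⇒zero r r≢1 zero    ([] , ())
leading101⇒zero r r≢1 zero    (_ ∷ _ , ())
leading101⇒zero r r≢1 (suc n) (low , digits) isOne =
  Blocks.∤1 r r≢1 (All.lookup (subst (λ ds → All (r ∣_) (zeroBlocks ds)) digits isOne)
                              (blockOfLength1 0 low))

-- Appending a low digit keeps the leading digits.
leading101-even : ∀ n → 0 < n → LeadingDigits101 n → LeadingDigits101 (n * 2)
leading101-even (suc q) _ (low , digits) = false ∷ low , trans (binDigits-even q) (cong (false ∷_) digits)

leading101-odd : ∀ q → LeadingDigits101 q → LeadingDigits101 (1 + q * 2)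
leading101-odd q (low , digits) = true ∷ low , trans (binDigits-odd q) (cong (true ∷_) digits)

-- 5·2^K = (101 0…0)₂; the numbers 5·2^K + i with i < 2^K all have leading digits 101.
block101 : ℕ → ℕ
block101 K = 2 ^ K * 5

block101-double : ∀ K j → block101 (suc K) + j * 2 ≡ (block101 K + j) * 2
block101-double K j = begin
  2 * 2 ^ K * 5 + j * 2   ≡⟨ cong (_+ j * 2) (*-assoc 2 (2 ^ K) 5) ⟩
  2 * block101 K + j * 2  ≡⟨ cong (_+ j * 2) (*-comm 2 (block101 K)) ⟩
  block101 K * 2 + j * 2  ≡⟨ *-distribʳ-+ 2 (block101 K) j ⟨
  (block101 K + j) * 2    ∎
  where open ≡-Reasoning

block101-positive : ∀ K j → 0 < block101 K + j
block101-positive K j = ≤-trans (m^n>0 2 K) (≤-trans (m≤m*n (2 ^ K) 5) (m≤m+n (block101 K) j))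

halfBelow : ∀ K j i → j * 2 ≤ i → i < 2 ^ suc K → j < 2 ^ K
halfBelow K j i 2j≤i i<2^K+1 = *-cancelʳ-< 2 j (2 ^ K) (≤-<-trans 2j≤i (subst (i <_) (*-comm 2 (2 ^ K)) i<2^K+1))

leading101-interval : ∀ K i → i < 2 ^ K → LeadingDigits101 (block101 K + i)
leading101-interval zero    zero    _         = [] , refl
leading101-interval zero    (suc i) (s≤s ())
leading101-interval (suc K) i i<2^K+1 with parity i
... | j , inj₁ refl = subst LeadingDigits101 (sym (block101-double K j))
                        (leading101-even (block101 K + j) (block101-positive K j)
                          (leading101-interval K j (halfBelow K j (j * 2) ≤-refl i<2^K+1)))
... | j , inj₂ refl = subst LeadingDigits101 oddShape
                        (leading101-odd (block101 K + j)
                          (leading101-interval K j (halfBelow K j (1 + j * 2) (m≤n+m (j * 2) 1) i<2^K+1)))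
  where
  oddShape : 1 + (block101 K + j) * 2 ≡ block101 (suc K) + (1 + j * 2)
  oddShape = trans (cong suc (sym (block101-double K j))) (sym (+-suc (block101 (suc K)) (j * 2)))

-- A run of length L fits below 2^L.
n<2^n : ∀ n → n < 2 ^ n
n<2^n zero    = s≤s z≤n
n<2^n (suc n) = begin-strict
  suc n              ≡⟨ +-comm 1 n ⟩
  n + 1              <⟨ +-mono-<-≤ (n<2^n n) (m^n>0 2 n) ⟩
  2 ^ n + 2 ^ n      ≡⟨ cong (2 ^ n +_) (sym (+-identityʳ (2 ^ n))) ⟩
  2 ^ suc n          ∎
  where open ≤-Reasoning

mainTheorem15 : (r : ℕ) → 2 ≤ r →
    ((L : ℕ) → Σ ℕ (λ m → (i : ℕ) → i < L → IsZero r (m + i)))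
    × (Σ ℕ (λ m → IsOne r m × IsOne r (m + 1)))
    × ((m : ℕ) → ¬ (IsOne r m × IsOne r (m + 1) × IsOne r (m + 2)))
mainTheorem15 r 2≤r = longZeroRuns , runOfTwoOnes , Blocks.noThreeOnes r r≢1
  where
  r≢1 : r ≢ 1
  r≢1 = >⇒≢ 2≤r

  longZeroRuns : (L : ℕ) → Σ ℕ (λ m → (i : ℕ) → i < L → IsZero r (m + i))
  longZeroRuns L = block101 L , λ i i<L →
    leading101⇒zero r r≢1 (block101 L + i) (leading101-interval L i (<-trans i<L (n<2^n L)))

  -- b₀ = b₁ = 1, since 1 = (1)₂ has no 0's.
  runOfTwoOnes : Σ ℕ (λ m → IsOne r m × IsOne r (m + 1))
  runOfTwoOnes = 0 , _ , All.[]
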